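{- Let $w$ be a finite word with $\mathcal{A}=\mathrm{Alph}(w)$, $|\mathcal{A}|\ge 2$, and let $m=\min\{K_w,R_w\}$, $M=\max\{K_w,R_w\}$. Then $|w|=R_w+K_w+|\mathcal{A}|-2$ if and only if the factor complexity of $w$ satisfies $C_w(0)=1$, $C_w(i)=|\mathcal{A}|+i-1$ for $1\le i\le m$, $C_w(i+1)=C_w(i)$ for $m\le i\le M-1$, and $C_w(i+1)=C_w(i)-1$ for $M\le i\le |w|$. Moreover, when these equivalent conditions hold, $C_w(R_w)=C_w(K_w)$ and the maximal value of $C_w$ is $m+|\mathcal{A}|-1$.
   Context: Words are finite sequences of letters; $|w|$ is the length and $\mathrm{Alph}(w)$ the set of letters of $w$. A factor is a contiguous subword (including the empty word). $C_w(n)$ is the number of distinct factors of $w$ of length $n$, with $C_w(n)=0$ for $n>|w|$. A factor $u$ of $w$ is right special if $ux$ is a factor of $w$ for at least two distinct letters $x$. $R_w$ is the smallest positive integer $r$ such that $w$ has no right special factor of length $r$; $K_w$ is the length of the shortest suffix of $w$ occurring exactly once in $w$. -}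

module Defs where

open import Data.Nat using (ℕ; zero; suc; _+_; _∸_; _≤_; _<_; _≤?_)
open import Data.List using (List; []; _∷_; _++_; [_]; length; take; drop; map; upTo; deduplicate)
open import Data.List.Properties using (≡-dec)
open import Data.Product using (Σ; ∃; _×_; _,_)
open import Relation.Binary.PropositionalEquality using (_≡_; _≢_)
open import Relation.Binary.Definitions using (DecidableEquality)
open import Relation.Nullary using (¬_; does)
open import Data.Bool using (if_then_else_)

module _ {A : Set} where

  IsFactor : List A → List A → Set
  IsFactor u w = Σ (List A) λ p → Σ (List A) λ s → w ≡ p ++ u ++ s

  OccursAt : List A → List A → ℕ → Set
  OccursAt u w i = Σ (List A) λ p → Σ (List A) λ s → length p ≡ i × w ≡ p ++ u ++ s

  OccursExactlyOnce : List A → List A → Set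
  OccursExactlyOnce u w = Σ ℕ λ i → OccursAt u w i × (∀ j → OccursAt u w j → j ≡ i)

  RightSpecial : List A → List A → Set
  RightSpecial u w = Σ A λ x → Σ A λ y → x ≢ y × IsFactor (u ++ [ x ]) w × IsFactor (u ++ [ y ]) w

  HasRightSpecialOfLength : List A → ℕ → Set
  HasRightSpecialOfLength w n = Σ (List A) λ u → length u ≡ n × RightSpecial u w

  IsR : List A → ℕ → Set
  IsR w r = 1 ≤ r × ¬ HasRightSpecialOfLength w r
            × (∀ r' → 1 ≤ r' → r' < r → HasRightSpecialOfLength w r')

  suffix : ℕ → List A → List A
  suffix k w = drop (length w ∸ k) w

  IsK : List A → ℕ → Set
  IsK w k = k ≤ length w × OccursExactlyOnce (suffix k w) w
            × (∀ k' → k' < k → ¬ OccursExactlyOnce (suffix k' w) w)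

  module _ (_≟_ : DecidableEquality A) where

    alphSize : List A → ℕ
    alphSize w = length (deduplicate _≟_ w)

    factorsOfLength : ℕ → List A → List (List A)
    factorsOfLength n w =
      if does (n ≤? length w)
      then map (λ i → take n (drop i w)) (upTo (suc (length w ∸ n)))
      else []

    -- factor complexity C_w(n) (= 0 for n > |w|)
    C : List A → ℕ → ℕ
    C w n = length (deduplicate (≡-dec _≟_) (factorsOfLength n w))

module Submission where

-- The proof separates the combinatorics of words from an arithmetic fact
-- about integer sequences.
--
-- Let c : ℕ → ℕ with c 0 = 1, c = 0 beyond L, a ≤ c 1,
--    c n ≤ c (n+1) + 1, strict growth below m and weak growth below M.
--    The potential Φ i = c i + (m ∸ i) + (i ∸ M) is then non-decreasing, starts
--    at least at m + a ∸ 1 and ends at L + 1 ∸ M.  Hence L ≥ m + M + a ∸ 2,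
--    and equality holds iff Φ is constant on [1, L + 1], which unfolds
--    exactly into the announced profile of c (ascent, plateau, unit descent);
--    constancy of Φ also gives c m = c M and the maximal value m + a ∸ 1.
-- 3. Words.  Every factor of length n except possibly the suffix extends to
--    the right; the suffix also extends when n < K; a right special factor of
--    length n yields two extensions.  This gives the hypotheses of 2 for
--    c = C_w, m = min(R, K), M = max(R, K), and the theorem follows.

open import Defs
open import Data.Nat using (ℕ; zero; suc; _+_; _∸_; _≤_; _<_; _⊓_; _⊔_; z≤n; s≤s; _<?_; _≤?_)
open import Data.Nat.Properties
open import Data.Nat.Tactic.RingSolver using (solve-∀)
open import Data.List using (List; []; _∷_; _++_; [_]; length; take; drop; map; filter; upTo; deduplicate)
open import Data.List.Properties
  using (≡-dec; length-map; filter-notAll; ++-cancelˡ; length-++; length-take; length-drop;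
         take++drop≡id; ++-assoc; ++-identityʳ; ∷-injectiveˡ; drop-all; length-deduplicate)
open import Data.List.Membership.Propositional using (_∈_; _∉_)
open import Data.List.Membership.Propositional.Properties
  using (∈-map⁺; ∈-map⁻; ∈-filter⁺; ∈-upTo⁺; ∈-upTo⁻; ∈-∃++; ∈-deduplicate⁺; ∈-deduplicate⁻)
import Data.List.Membership.DecPropositional as DecMembership
open import Data.List.Relation.Unary.Any using (here; there)
import Data.List.Relation.Unary.Any as Any
import Data.List.Relation.Unary.All as All
open import Data.List.Relation.Unary.All using (_∷_)
open import Data.List.Relation.Unary.AllPairs using (_∷_)
open import Data.List.Relation.Unary.Unique.Propositional using (Unique)
open import Data.List.Relation.Unary.Unique.Propositional.Properties using (map⁺)
open import Data.List.Relation.Unary.Unique.DecPropositional.Properties using (deduplicate-!)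
open import Data.List.Relation.Binary.Subset.Propositional using (_⊆_)
open import Data.Product using (Σ; _×_; _,_; proj₁; proj₂)
open import Data.Sum using (_⊎_; inj₁; inj₂)
open import Data.Empty using (⊥-elim)
open import Relation.Binary.PropositionalEquality
  using (_≡_; _≢_; refl; sym; trans; cong; cong₂; subst; module ≡-Reasoning)
open import Relation.Binary.Core using (Rel)
open import Relation.Binary.Definitions using (DecidableEquality; Reflexive; Transitive)
open import Relation.Nullary using (yes; no; ¬?)
open import Relation.Nullary.Decidable using (dec-true; dec-false)
open import Function.Bundles using (_⇔_; mk⇔; Equivalence)
open import Function.Definitions using (Injective)
open import Function.Properties.Equivalence using () renaming (trans to ⇔-trans)
open import Level using (0ℓ)

module DistinctCount {A : Set} (_≟_ : DecidableEquality A) where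

  distinct : List A → ℕ
  distinct xs = length (deduplicate _≟_ xs)

  without : A → List A → List A
  without x = filter (λ z → ¬? (x ≟ z))

  ∈-without : ∀ {x z ys} → z ∈ ys → x ≢ z → z ∈ without x ys
  ∈-without z∈ys x≢z = ∈-filter⁺ _ z∈ys x≢z

  length-without : ∀ {x ys} → x ∈ ys → length (without x ys) < length ys
  length-without {ys = ys} x∈ys = filter-notAll _ ys (Any.map (λ x≡z x≢z → x≢z x≡z) x∈ys)

  unique-⊆-length : ∀ {xs ys : List A} → Unique xs → xs ⊆ ys → length xs ≤ length ys
  unique-⊆-length {[]}     _                 _     = z≤n
  unique-⊆-length {x ∷ xs} {ys} (x∉xs ∷ xs-unique) xs⊆ys =
    ≤-<-trans (unique-⊆-length xs-unique rest⊆) (length-without (xs⊆ys (here refl)))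
    where
    rest⊆ : xs ⊆ without x ys
    rest⊆ z∈xs = ∈-without (xs⊆ys (there z∈xs)) (All.lookup x∉xs z∈xs)

  distinct-≤ : ∀ {xs ys} → xs ⊆ ys → distinct xs ≤ length ys
  distinct-≤ {xs} xs⊆ys = unique-⊆-length (deduplicate-! _≟_ xs) (λ z → xs⊆ys (∈-deduplicate⁻ _≟_ xs z))

  distinct-mono : ∀ {xs ys} → xs ⊆ ys → distinct xs ≤ distinct ys
  distinct-mono xs⊆ys = distinct-≤ (λ z → ∈-deduplicate⁺ _≟_ (xs⊆ys z))

  two-members : ∀ {ys} → Unique ys → 2 ≤ length ys → Σ A λ x → Σ A λ y → x ∈ ys × y ∈ ys × x ≢ y
  two-members {x ∷ y ∷ _} ((x≢y ∷ _) ∷ _) _ = x , y , here refl , there (here refl) , x≢y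
  two-members {_ ∷ []}    _               (s≤s ())

  two-distinct : ∀ xs → 2 ≤ distinct xs → Σ A λ x → Σ A λ y → x ∈ xs × y ∈ xs × x ≢ y
  two-distinct xs 2≤ with x , y , x∈ , y∈ , x≢y ← two-members (deduplicate-! _≟_ xs) 2≤ =
    x , y , ∈-deduplicate⁻ _≟_ xs x∈ , ∈-deduplicate⁻ _≟_ xs y∈ , x≢y

module DistinctMap {A B : Set} (_≟A_ : DecidableEquality A) (_≟B_ : DecidableEquality B) (f : A → B) where

  open DistinctCount _≟A_ using (without; ∈-without; length-without) renaming (distinct to distinctA)
  open DistinctCount _≟B_ using (unique-⊆-length) renaming (distinct to distinctB; distinct-≤ to distinctB-≤)

  distinct-map : ∀ xs → distinctB (map f xs) ≤ distinctA xs
  distinct-map xs = subst (_ ≤_) (length-map f (deduplicate _≟A_ xs)) (distinctB-≤ cover)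
    where
    cover : map f xs ⊆ map f (deduplicate _≟A_ xs)
    cover v∈ with z , z∈xs , refl ← ∈-map⁻ f v∈ = ∈-map⁺ f (∈-deduplicate⁺ _≟A_ z∈xs)

  distinct-map-strict : ∀ {xs x y} → x ∈ xs → y ∈ xs → x ≢ y → f x ≡ f y →
                        suc (distinctB (map f xs)) ≤ distinctA xs
  distinct-map-strict {xs} {x} {y} x∈xs y∈xs x≢y fx≡fy =
    ≤-<-trans (subst (_ ≤_) (length-map f rest) (distinctB-≤ cover))
              (length-without (∈-deduplicate⁺ _≟A_ x∈xs))
    where
    rest = without x (deduplicate _≟A_ xs)
    cover : map f xs ⊆ map f rest
    cover v∈ with z , z∈xs , refl ← ∈-map⁻ f v∈ with x ≟A z
    ... | yes refl = subst (_∈ map f rest) (sym fx≡fy) (∈-map⁺ f (∈-without (∈-deduplicate⁺ _≟A_ y∈xs) x≢y))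
    ... | no x≢z  = ∈-map⁺ f (∈-without (∈-deduplicate⁺ _≟A_ z∈xs) x≢z)

  distinct-map-injective : Injective _≡_ _≡_ f → ∀ xs → distinctA xs ≤ distinctB (map f xs)
  distinct-map-injective f-inj xs =
    subst (_≤ _) (length-map f (deduplicate _≟A_ xs))
      (unique-⊆-length (map⁺ f-inj (deduplicate-! _≟A_ xs)) cover)
    where
    cover : map f (deduplicate _≟A_ xs) ⊆ deduplicate _≟B_ (map f xs)
    cover v∈ with z , z∈ , refl ← ∈-map⁻ f v∈ = ∈-deduplicate⁺ _≟B_ (∈-map⁺ f (∈-deduplicate⁻ _≟A_ xs z∈))

telescope : {R : Rel ℕ 0ℓ} → Reflexive R → Transitive R → (f : ℕ → ℕ) {p q : ℕ} →
            (∀ i → p ≤ i → i < q → R (f i) (f (suc i))) → p ≤ q → R (f p) (f q)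
telescope {R} refl′ trans′ f {q = zero}  steps z≤n = refl′
telescope {R} refl′ trans′ f {q = suc q} steps p≤1+q with m≤n⇒m<n∨m≡n p≤1+q
... | inj₂ refl         = refl′
... | inj₁ (s≤s p≤q) =
  trans′ (telescope {R} refl′ trans′ f (λ i p≤i i<q → steps i p≤i (m≤n⇒m≤1+n i<q)) p≤q) (steps q p≤q ≤-refl)

-- The length equation of the theorem, rewritten as the height of the final descent.
length-equation : ∀ {L a m M} → 1 ≤ m → 2 ≤ a → M ≤ suc L →
                  (L ≡ m + M + a ∸ 2) ⇔ (suc L ∸ M ≡ m + a ∸ 1)
length-equation {L} {suc (suc a′)} {suc m′} {M} (s≤s z≤n) (s≤s (s≤s z≤n)) M≤1+L = mk⇔
  (λ L≡ → trans (cong (_∸ M) (trans (cong suc L≡) total)) (m+n∸m≡n M _))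
  (λ h≡ → suc-injective (trans (sym (m+[n∸m]≡n M≤1+L)) (trans (cong (M +_) h≡) (sym total))))
  where
  total : suc (suc m′ + M + suc (suc a′) ∸ 2) ≡ M + (suc m′ + suc (suc a′) ∸ 1)
  total = trans (cong (λ x → suc (x ∸ 1)) (+-suc (m′ + M) (suc a′))) (normalise a′ m′ M)
    where
    normalise : ∀ a′ m′ M → suc (m′ + M + suc a′) ≡ M + (m′ + suc (suc a′))
    normalise = solve-∀

climb-split : ∀ a {i m} → 1 ≤ i → i ≤ m → (a + i ∸ 1) + (m ∸ i) ≡ m + a ∸ 1
climb-split a {suc i′} {suc m′} (s≤s z≤n) (s≤s i′≤m′) = begin
  (a + suc i′ ∸ 1) + (m′ ∸ i′) ≡⟨ cong (_+ (m′ ∸ i′)) (+-∸-assoc a (s≤s z≤n)) ⟩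
  a + i′ + (m′ ∸ i′)           ≡⟨ +-assoc a i′ (m′ ∸ i′) ⟩
  a + (i′ + (m′ ∸ i′))         ≡⟨ cong (a +_) (m+[n∸m]≡n i′≤m′) ⟩
  a + m′                       ≡⟨ +-comm a m′ ⟩
  suc m′ + a ∸ 1               ∎
  where open ≡-Reasoning

≡-transport : ∀ {x x′ y y′ : ℕ} → x ≡ x′ → y ≡ y′ → (x ≡ y) ⇔ (x′ ≡ y′)
≡-transport refl refl = mk⇔ (λ e → e) (λ e → e)

+-cancelʳ-⇔ : ∀ {x y} d → (x + d ≡ y + d) ⇔ (x ≡ y)
+-cancelʳ-⇔ {x} {y} d = mk⇔ (+-cancelʳ-≡ d x y) (cong (_+ d))

module Envelope (c : ℕ → ℕ) (L a m M : ℕ)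
  (c-empty   : c 0 ≡ 1)
  (c-beyond  : ∀ n → L < n → c n ≡ 0)
  (c-letters : a ≤ c 1)
  (c-down    : ∀ n → c n ≤ suc (c (suc n)))
  (c-up      : ∀ n → n < m → suc (c n) ≤ c (suc n))
  (c-flat    : ∀ n → n < M → c n ≤ c (suc n))
  (1≤m : 1 ≤ m) (m≤M : m ≤ M) (M≤L : M ≤ L) (2≤a : 2 ≤ a)
  where

  open ≤-Reasoning

  -- the value c reaches at the end of its ascent, at m
  peak : ℕ
  peak = m + a ∸ 1

  M≤1+L : M ≤ suc L
  M≤1+L = m≤n⇒m≤1+n M≤L

  Profile : Set
  Profile = (c 0 ≡ 1)
          × (∀ i → 1 ≤ i → i ≤ m → c i ≡ a + i ∸ 1)
          × (∀ i → m ≤ i → i < M → c (suc i) ≡ c i)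
          × (∀ i → M ≤ i → i ≤ L → c (suc i) + 1 ≡ c i)

  -- the potential: c corrected by the ascent still missing before m and the
  -- descent already made after M; its value in each of the three regimes follows
  Φ : ℕ → ℕ
  Φ i = c i + (m ∸ i) + (i ∸ M)

  Φ-low : ∀ {i} → i ≤ m → Φ i ≡ c i + (m ∸ i)
  Φ-low {i} i≤m = trans (cong (c i + (m ∸ i) +_) (m≤n⇒m∸n≡0 (≤-trans i≤m m≤M))) (+-identityʳ _)

  Φ-mid : ∀ {i} → m ≤ i → i ≤ M → Φ i ≡ c i
  Φ-mid {i} m≤i i≤M = begin-equality
    c i + (m ∸ i) + (i ∸ M) ≡⟨ cong₂ (λ x y → c i + x + y) (m≤n⇒m∸n≡0 m≤i) (m≤n⇒m∸n≡0 i≤M) ⟩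
    c i + 0 + 0             ≡⟨ +-identityʳ _ ⟩
    c i + 0                 ≡⟨ +-identityʳ _ ⟩
    c i                     ∎

  Φ-high : ∀ {i} → M ≤ i → Φ i ≡ c i + (i ∸ M)
  Φ-high {i} M≤i = cong (_+ (i ∸ M)) (trans (cong (c i +_) (m≤n⇒m∸n≡0 (≤-trans m≤M M≤i))) (+-identityʳ _))

  Φ-after : ∀ {i} → M ≤ i → Φ (suc i) ≡ suc (c (suc i)) + (i ∸ M)
  Φ-after {i} M≤i = begin-equality
    Φ (suc i)                  ≡⟨ Φ-high (m≤n⇒m≤1+n M≤i) ⟩
    c (suc i) + (suc i ∸ M)    ≡⟨ cong (c (suc i) +_) (+-∸-assoc 1 M≤i) ⟩
    c (suc i) + suc (i ∸ M)    ≡⟨ +-suc (c (suc i)) (i ∸ M) ⟩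
    suc (c (suc i)) + (i ∸ M)  ∎

  Φ-step : ∀ i → Φ i ≤ Φ (suc i)
  Φ-step i with i <? m | i <? M
  ... | yes i<m | _ = begin
    Φ i                          ≡⟨ Φ-low (<⇒≤ i<m) ⟩
    c i + (m ∸ i)                ≡⟨ cong (c i +_) (+-∸-assoc 1 i<m) ⟩
    c i + suc (m ∸ suc i)        ≡⟨ +-suc (c i) (m ∸ suc i) ⟩
    suc (c i) + (m ∸ suc i)      ≤⟨ +-monoˡ-≤ (m ∸ suc i) (c-up i i<m) ⟩
    c (suc i) + (m ∸ suc i)      ≡⟨ Φ-low i<m ⟨
    Φ (suc i)                    ∎
  ... | no i≮m | yes i<M = begin
    Φ i                          ≡⟨ Φ-mid (≮⇒≥ i≮m) (<⇒≤ i<M) ⟩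
    c i                          ≤⟨ c-flat i i<M ⟩
    c (suc i)                    ≡⟨ Φ-mid (m≤n⇒m≤1+n (≮⇒≥ i≮m)) i<M ⟨
    Φ (suc i)                    ∎
  ... | no _ | no i≮M = begin
    Φ i                          ≡⟨ Φ-high (≮⇒≥ i≮M) ⟩
    c i + (i ∸ M)                ≤⟨ +-monoˡ-≤ (i ∸ M) (c-down i) ⟩
    suc (c (suc i)) + (i ∸ M)    ≡⟨ Φ-after (≮⇒≥ i≮M) ⟨
    Φ (suc i)                    ∎

  Φ-mono : ∀ {i j} → i ≤ j → Φ i ≤ Φ j
  Φ-mono = telescope {_≤_} ≤-refl ≤-trans Φ (λ i _ _ → Φ-step i)

  Φ-start : peak ≤ Φ 1
  Φ-start = begin
    m + a ∸ 1       ≡⟨ +-∸-comm a 1≤m ⟩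
    (m ∸ 1) + a     ≤⟨ +-monoʳ-≤ (m ∸ 1) c-letters ⟩
    (m ∸ 1) + c 1   ≡⟨ +-comm (m ∸ 1) (c 1) ⟩
    c 1 + (m ∸ 1)   ≡⟨ Φ-low 1≤m ⟨
    Φ 1             ∎

  Φ-end : Φ (suc L) ≡ suc L ∸ M
  Φ-end = trans (Φ-high M≤1+L) (cong (_+ (suc L ∸ M)) (c-beyond (suc L) ≤-refl))

  Φ-level : Φ (suc L) ≡ peak → ∀ i → 1 ≤ i → i ≤ suc L → Φ i ≡ peak
  Φ-level end i 1≤i i≤1+L =
    ≤-antisym (≤-trans (Φ-mono i≤1+L) (≤-reflexive end)) (≤-trans Φ-start (Φ-mono 1≤i))

  flat-step : ∀ {i} → m ≤ i → i < M → (Φ (suc i) ≡ Φ i) ⇔ (c (suc i) ≡ c i)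
  flat-step m≤i i<M = ≡-transport (Φ-mid (m≤n⇒m≤1+n m≤i) i<M) (Φ-mid m≤i (<⇒≤ i<M))

  descent-step : ∀ {i} → M ≤ i → (Φ (suc i) ≡ Φ i) ⇔ (c (suc i) + 1 ≡ c i)
  descent-step {i} M≤i =
    ⇔-trans (≡-transport (trans (Φ-after M≤i) (cong (_+ (i ∸ M)) (+-comm 1 (c (suc i))))) (Φ-high M≤i))
            (+-cancelʳ-⇔ (i ∸ M))

  level⇒profile : Φ (suc L) ≡ peak → Profile
  level⇒profile end = c-empty , ascent , flat , descent
    where
    level : ∀ i → 1 ≤ i → i ≤ suc L → Φ i ≡ peak
    level = Φ-level end
    level-step : ∀ i → 1 ≤ i → i ≤ L → Φ (suc i) ≡ Φ i
    level-step i 1≤i i≤L = trans (level (suc i) (s≤s z≤n) (s≤s i≤L)) (sym (level i 1≤i (m≤n⇒m≤1+n i≤L)))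
    ascent : ∀ i → 1 ≤ i → i ≤ m → c i ≡ a + i ∸ 1
    ascent i 1≤i i≤m = +-cancelʳ-≡ (m ∸ i) (c i) (a + i ∸ 1) (begin-equality
      c i + (m ∸ i)          ≡⟨ Φ-low i≤m ⟨
      Φ i                    ≡⟨ level i 1≤i (≤-trans i≤m (≤-trans m≤M M≤1+L)) ⟩
      peak                   ≡⟨ climb-split a 1≤i i≤m ⟨
      a + i ∸ 1 + (m ∸ i)    ∎)
    flat : ∀ i → m ≤ i → i < M → c (suc i) ≡ c i
    flat i m≤i i<M = Equivalence.to (flat-step m≤i i<M)
      (level-step i (≤-trans 1≤m m≤i) (≤-trans (<⇒≤ i<M) M≤L))
    descent : ∀ i → M ≤ i → i ≤ L → c (suc i) + 1 ≡ c i
    descent i M≤i i≤L = Equivalence.to (descent-step M≤i)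
      (level-step i (≤-trans 1≤m (≤-trans m≤M M≤i)) i≤L)

  profile-top : Profile → c m ≡ peak
  profile-top (_ , ascent , _ , _) = trans (ascent m 1≤m ≤-refl) (cong (_∸ 1) (+-comm a m))

  profile⇒level : Profile → Φ (suc L) ≡ peak
  profile⇒level profile@(_ , _ , flat , descent) = begin-equality
    Φ (suc L)  ≡⟨ telescope {_≡_} refl trans Φ step (≤-trans m≤M M≤1+L) ⟨
    Φ m        ≡⟨ Φ-mid ≤-refl m≤M ⟩
    c m        ≡⟨ profile-top profile ⟩
    peak       ∎
    where
    step : ∀ i → m ≤ i → i < suc L → Φ i ≡ Φ (suc i)
    step i m≤i i<1+L with i <? M
    ... | yes i<M = sym (Equivalence.from (flat-step m≤i i<M) (flat i m≤i i<M))
    ... | no i≮M  = sym (Equivalence.from (descent-step (≮⇒≥ i≮M)) (descent i (≮⇒≥ i≮M) (≤-pred i<1+L)))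

  length⇔profile : (L ≡ m + M + a ∸ 2) ⇔ Profile
  length⇔profile =
    ⇔-trans (length-equation 1≤m 2≤a (m≤n⇒m≤1+n M≤L))
    (⇔-trans (≡-transport (sym Φ-end) refl) (mk⇔ level⇒profile profile⇒level))

  c≤Φ : ∀ i → c i ≤ Φ i
  c≤Φ i = ≤-trans (m≤m+n (c i) (m ∸ i)) (m≤m+n _ (i ∸ M))

  profile-peak : Profile → (c m ≡ c M) × (∀ n → c n ≤ peak) × Σ ℕ (λ n → c n ≡ peak)
  profile-peak profile = plateau , bound , (m , profile-top profile)
    where
    level : ∀ i → 1 ≤ i → i ≤ suc L → Φ i ≡ peak
    level = Φ-level (profile⇒level profile)
    plateau : c m ≡ c M
    plateau = begin-equality
      c m   ≡⟨ Φ-mid ≤-refl m≤M ⟨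
      Φ m   ≡⟨ level m 1≤m (≤-trans m≤M M≤1+L) ⟩
      peak  ≡⟨ level M (≤-trans 1≤m m≤M) M≤1+L ⟨
      Φ M   ≡⟨ Φ-mid m≤M ≤-refl ⟩
      c M   ∎
    bound : ∀ n → c n ≤ peak
    bound zero = begin
      c 0          ≡⟨ c-empty ⟩
      1            ≤⟨ ≤-trans (s≤s z≤n) 2≤a ⟩
      a            ≤⟨ m≤n+m a (m ∸ 1) ⟩
      (m ∸ 1) + a  ≡⟨ +-∸-comm a 1≤m ⟨
      peak         ∎
    bound (suc n) with suc n ≤? L
    ... | yes n<L = ≤-trans (c≤Φ (suc n)) (≤-reflexive (level (suc n) (s≤s z≤n) (m≤n⇒m≤1+n n<L)))
    ... | no n≮L  = ≤-trans (≤-reflexive (c-beyond (suc n) (≰⇒> n≮L))) z≤n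

module _ {A : Set} where

  take-length-++ : ∀ (u s : List A) → take (length u) (u ++ s) ≡ u
  take-length-++ []      s = refl
  take-length-++ (x ∷ u) s = cong (x ∷_) (take-length-++ u s)

  drop-length-++ : ∀ (p s : List A) → drop (length p) (p ++ s) ≡ s
  drop-length-++ []      s = refl
  drop-length-++ (x ∷ p) s = drop-length-++ p s

  length-snoc : ∀ (u : List A) x → length (u ++ [ x ]) ≡ suc (length u)
  length-snoc u x = trans (length-++ u) (+-comm (length u) 1)

  length-occurrence : ∀ (p u s : List A) → length (p ++ u ++ s) ≡ length p + length u + length s
  length-occurrence p u s = trans (length-++ p) (trans (cong (length p +_) (length-++ u)) (sym (+-assoc (length p) _ _)))

  empty-occurs-twice : ∀ (v : List A) → 1 ≤ length v → OccursAt [] v 0 × OccursAt [] v 1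
  empty-occurs-twice (x ∷ v) _ = ([] , x ∷ v , refl , refl) , ([ x ] , v , refl , refl)

module Factors {A : Set} (_≟_ : DecidableEquality A) (w : List A) where

  open DistinctCount (≡-dec _≟_) using (distinct; distinct-≤; distinct-mono)

  L : ℕ
  L = length w

  F : ℕ → List (List A)
  F n = factorsOfLength _≟_ n w

  c : ℕ → ℕ
  c = C _≟_ w

  -- length-n factors having a right extension in w (listed with repetitions)
  Ext : ℕ → List (List A)
  Ext n = map (take n) (F (suc n))

  window : ℕ → ℕ → List A
  window n i = take n (drop i w)

  F-≤ : ∀ {n} → n ≤ L → F n ≡ map (window n) (upTo (suc (L ∸ n)))
  F-≤ {n} n≤L rewrite dec-true (n ≤? L) n≤L = refl

  F-> : ∀ {n} → L < n → F n ≡ []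
  F-> {n} L<n rewrite dec-false (n ≤? L) (<⇒≱ L<n) = refl

  factor∈F : ∀ u → IsFactor u w → u ∈ F (length u)
  factor∈F u (p , s , refl) = subst (u ∈_) (sym (F-≤ (m+n≤o⇒n≤o (length p) p+u≤L)))
    (subst (_∈ map (window (length u)) (upTo (suc (L ∸ length u)))) window≡u
      (∈-map⁺ (window (length u)) (∈-upTo⁺ (s≤s (m+n≤o⇒m≤o∸n (length p) p+u≤L)))))
    where
    p+u≤L : length p + length u ≤ L
    p+u≤L = subst (length p + length u ≤_) (sym (length-occurrence p u s)) (m≤m+n _ (length s))
    window≡u : window (length u) (length p) ≡ u
    window≡u = trans (cong (take (length u)) (drop-length-++ p (u ++ s))) (take-length-++ u s)

  ∈F⇒factor : ∀ {n u} → u ∈ F n → IsFactor u w × length u ≡ n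
  ∈F⇒factor {n} {u} u∈ with n ≤? L
  ... | no n≰L with () ← subst (u ∈_) (F-> (≰⇒> n≰L)) u∈
  ... | yes n≤L with i , i∈ , refl ← ∈-map⁻ (window n) (subst (u ∈_) (F-≤ n≤L) u∈) =
    (take i w , drop n (drop i w) , sym split) , length-window
    where
    split : take i w ++ take n (drop i w) ++ drop n (drop i w) ≡ w
    split = trans (cong (take i w ++_) (take++drop≡id n (drop i w))) (take++drop≡id i w)
    n≤L∸i : n ≤ L ∸ i
    n≤L∸i = m+n≤o⇒m≤o∸n n (subst (_≤ L) (+-comm i n) (m≤o∸n⇒m+n≤o i n≤L (≤-pred (∈-upTo⁻ i∈))))
    length-window : length (take n (drop i w)) ≡ n
    length-window = trans (length-take n (drop i w)) (m≤n⇒m⊓n≡m (subst (n ≤_) (sym (length-drop i w)) n≤L∸i))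

  ∈F⇒≤ : ∀ {n u} → u ∈ F n → n ≤ L
  ∈F⇒≤ {n} {u} u∈ with n ≤? L
  ... | yes n≤L = n≤L
  ... | no n≰L with () ← subst (u ∈_) (F-> (≰⇒> n≰L)) u∈

  snoc∈F : ∀ {u x} → IsFactor (u ++ [ x ]) w → u ++ [ x ] ∈ F (suc (length u))
  snoc∈F {u} {x} ux = subst (λ n → u ++ [ x ] ∈ F n) (length-snoc u x) (factor∈F (u ++ [ x ]) ux)

  extendable : ∀ p u x s → w ≡ p ++ u ++ x ∷ s → u ∈ Ext (length u)
  extendable p u x s w≡ = subst (_∈ Ext (length u)) (take-length-++ u [ x ])
    (∈-map⁺ (take (length u)) (snoc∈F (p , s , trans w≡ (cong (p ++_) (sym (++-assoc u [ x ] s))))))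

  final-occurrence : ∀ p u → w ≡ p ++ u ++ [] → (L ∸ length u ≡ length p) × (suffix (length u) w ≡ u)
  final-occurrence p u refl = position , (begin
    drop (L ∸ length u) (p ++ u ++ []) ≡⟨ cong (λ i → drop i (p ++ u ++ [])) position ⟩
    drop (length p) (p ++ u ++ [])     ≡⟨ drop-length-++ p (u ++ []) ⟩
    u ++ []                            ≡⟨ ++-identityʳ u ⟩
    u                                  ∎)
    where
    open ≡-Reasoning
    position : length (p ++ u ++ []) ∸ length u ≡ length p
    position = trans (cong (_∸ length u) (trans (length-occurrence p u []) (+-identityʳ _)))
                     (m+n∸n≡m (length p) (length u))

  F⊆suffix∷Ext : ∀ n → F n ⊆ suffix n w ∷ Ext n
  F⊆suffix∷Ext n u∈ with ∈F⇒factor u∈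
  ... | (p , []    , w≡) , refl = here (sym (proj₂ (final-occurrence p _ w≡)))
  ... | (p , x ∷ s , w≡) , refl = there (extendable p _ x s w≡)

  c≤1+Ext : ∀ n → c n ≤ suc (distinct (Ext n))
  c≤1+Ext n = distinct-≤ cover
    where
    cover : F n ⊆ suffix n w ∷ deduplicate (≡-dec _≟_) (Ext n)
    cover u∈ with F⊆suffix∷Ext n u∈
    ... | here u≡  = here u≡
    ... | there u∈Ext = there (∈-deduplicate⁺ (≡-dec _≟_) u∈Ext)

  Ext≤c : ∀ n → distinct (Ext n) ≤ c (suc n)
  Ext≤c n = DistinctMap.distinct-map (≡-dec _≟_) (≡-dec _≟_) (take n) (F (suc n))

  -- a right special factor of length n contributes two of them
  special⇒Ext<c : ∀ {n} → HasRightSpecialOfLength w n → suc (distinct (Ext n)) ≤ c (suc n)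
  special⇒Ext<c (u , refl , x , y , x≢y , ux , uy) =
    DistinctMap.distinct-map-strict (≡-dec _≟_) (≡-dec _≟_) (take (length u))
      (snoc∈F ux) (snoc∈F uy) (λ ux≡uy → x≢y (∷-injectiveˡ (++-cancelˡ u [ x ] [ y ] ux≡uy)))
      (trans (take-length-++ u [ x ]) (sym (take-length-++ u [ y ])))

  special-length : ∀ {n} → HasRightSpecialOfLength w n → n < L
  special-length (u , refl , x , _ , _ , ux , _) = ∈F⇒≤ (snoc∈F ux)

  suffix-unique : ∀ {n} → n ≤ L → suffix n w ∉ Ext n → OccursExactlyOnce (suffix n w) w
  suffix-unique {n} n≤L ∉Ext = L ∸ n , at-end , only-at-end
    where
    length-suffix : length (suffix n w) ≡ n
    length-suffix = trans (length-drop (L ∸ n) w) (m∸[m∸n]≡n n≤L)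
    at-end : OccursAt (suffix n w) w (L ∸ n)
    at-end = take (L ∸ n) w , [] , trans (length-take (L ∸ n) w) (m≤n⇒m⊓n≡m (m∸n≤m L n)) ,
             sym (trans (cong (take (L ∸ n) w ++_) (++-identityʳ (suffix n w))) (take++drop≡id (L ∸ n) w))
    only-at-end : ∀ j → OccursAt (suffix n w) w j → j ≡ L ∸ n
    only-at-end j (p , []    , refl , w≡) =
      trans (sym (proj₁ (final-occurrence p (suffix n w) w≡))) (cong (L ∸_) length-suffix)
    only-at-end j (p , x ∷ s , refl , w≡) =
      ⊥-elim (∉Ext (subst (λ k → suffix n w ∈ Ext k) length-suffix (extendable p (suffix n w) x s w≡)))

  open DecMembership (≡-dec _≟_) using (_∈?_)

  -- below K the suffix repeats, so it is right-extendable
  suffix-extendable : ∀ {k n} → IsK w k → n < k → suffix n w ∈ Ext n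
  suffix-extendable {n = n} (k≤L , _ , below-K) n<k with suffix n w ∈? Ext n
  ... | yes ∈Ext = ∈Ext
  ... | no ∉Ext  = ⊥-elim (below-K n n<k (suffix-unique (≤-trans (<⇒≤ n<k) k≤L) ∉Ext))

  c≤Ext : ∀ {k n} → IsK w k → n < k → c n ≤ distinct (Ext n)
  c≤Ext {n = n} isK n<k = distinct-mono cover
    where
    cover : F n ⊆ Ext n
    cover u∈ with F⊆suffix∷Ext n u∈
    ... | here refl   = suffix-extendable isK n<k
    ... | there u∈Ext = u∈Ext

  c-empty : c 0 ≡ 1
  c-empty = ≤-antisym (distinct-≤ only-empty) (distinct-mono empty∈F)
    where
    only-empty : F 0 ⊆ [ [] ]
    only-empty {[]}    _  = here refl
    only-empty {_ ∷ _} u∈ with () ← proj₂ (∈F⇒factor {0} u∈)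
    empty∈F : [ [] ] ⊆ F 0
    empty∈F (here refl) = factor∈F [] ([] , w , refl)

  c-beyond : ∀ n → L < n → c n ≡ 0
  c-beyond n L<n = cong distinct (F-> L<n)

  -- every letter is a factor of length 1
  alphabet≤c1 : alphSize _≟_ w ≤ c 1
  alphabet≤c1 = ≤-trans (DistinctMap.distinct-map-injective _≟_ (≡-dec _≟_) [_] ∷-injectiveˡ w)
                        (distinct-mono letters)
    where
    letters : map [_] w ⊆ F 1
    letters v∈ with x , x∈ , refl ← ∈-map⁻ [_] v∈ = factor∈F [ x ] (∈-∃++ x∈)

  c-down : ∀ n → c n ≤ suc (c (suc n))
  c-down n = ≤-trans (c≤1+Ext n) (s≤s (Ext≤c n))

  special-empty : 2 ≤ alphSize _≟_ w → HasRightSpecialOfLength w 0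
  special-empty 2≤a with x , y , x∈ , y∈ , x≢y ← DistinctCount.two-distinct _≟_ w 2≤a =
    [] , refl , x , y , x≢y , ∈-∃++ x∈ , ∈-∃++ y∈

  -- every length below R carries a right special factor (length 0 by the two letters)
  special-below-R : ∀ {r} → IsR w r → 2 ≤ alphSize _≟_ w → ∀ n → n < r → HasRightSpecialOfLength w n
  special-below-R _                2≤a zero    _   = special-empty 2≤a
  special-below-R (_ , _ , below-R) _  (suc n) n<r = below-R (suc n) (s≤s z≤n) n<r

  -- a right special factor of length R - 1 has extensions of length R
  R≤L : ∀ {r} → IsR w r → 2 ≤ alphSize _≟_ w → r ≤ L
  R≤L {zero}  (() , _) _
  R≤L {suc r} isR 2≤a = special-length (special-below-R isR 2≤a r ≤-refl)

  -- the empty suffix occurs at least twice in a non-empty word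
  K-positive : 1 ≤ L → ∀ {k} → IsK w k → 1 ≤ k
  K-positive 1≤L {suc _} _ = s≤s z≤n
  K-positive 1≤L {zero} (_ , (i , _ , only-at-i) , _) =
    ⊥-elim (0≢1+n (trans (only-at-i 0 at-0) (sym (only-at-i 1 at-1))))
    where
    empty-suffix : [] ≡ suffix 0 w
    empty-suffix = sym (drop-all L w ≤-refl)
    at-0 : OccursAt (suffix 0 w) w 0
    at-0 = subst (λ u → OccursAt u w 0) empty-suffix (proj₁ (empty-occurs-twice w 1≤L))
    at-1 : OccursAt (suffix 0 w) w 1
    at-1 = subst (λ u → OccursAt u w 1) empty-suffix (proj₂ (empty-occurs-twice w 1≤L))

  c-climbs : ∀ {r k n} → IsR w r → IsK w k → 2 ≤ alphSize _≟_ w → n < r → n < k → suc (c n) ≤ c (suc n)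
  c-climbs {n = n} isR isK 2≤a n<r n<k =
    ≤-trans (s≤s (c≤Ext isK n<k)) (special⇒Ext<c (special-below-R isR 2≤a n n<r))

  c-grows-below-R : ∀ {r n} → IsR w r → 2 ≤ alphSize _≟_ w → n < r → c n ≤ c (suc n)
  c-grows-below-R {n = n} isR 2≤a n<r = ≤-trans (c≤1+Ext n) (special⇒Ext<c (special-below-R isR 2≤a n n<r))

  c-grows-below-K : ∀ {k n} → IsK w k → n < k → c n ≤ c (suc n)
  c-grows-below-K {n = n} isK n<k = ≤-trans (c≤Ext isK n<k) (Ext≤c n)

min-max-cases : ∀ r k → (r ⊓ k ≡ r × r ⊔ k ≡ k) ⊎ (r ⊓ k ≡ k × r ⊔ k ≡ r)
min-max-cases r k with ≤-total r k
... | inj₁ r≤k = inj₁ (m≤n⇒m⊓n≡m r≤k , m≤n⇒m⊔n≡n r≤k)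
... | inj₂ k≤r = inj₂ (m≥n⇒m⊓n≡n k≤r , m≥n⇒m⊔n≡m k≤r)

⊓+⊔ : ∀ r k → (r ⊓ k) + (r ⊔ k) ≡ r + k
⊓+⊔ r k with min-max-cases r k
... | inj₁ (min≡r , max≡k) = cong₂ _+_ min≡r max≡k
... | inj₂ (min≡k , max≡r) = trans (cong₂ _+_ min≡k max≡r) (+-comm k r)

agree-at-min-max : ∀ (f : ℕ → ℕ) r k → f (r ⊓ k) ≡ f (r ⊔ k) → f r ≡ f k
agree-at-min-max f r k f≡ with min-max-cases r k
... | inj₁ (min≡r , max≡k) = trans (cong f (sym min≡r)) (trans f≡ (cong f max≡k))
... | inj₂ (min≡k , max≡r) = sym (trans (cong f (sym min≡k)) (trans f≡ (cong f max≡r)))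

theorem2p2 : {A : Set} (_≟_ : DecidableEquality A) (w : List A) (r k : ℕ) →
    IsR w r → IsK w k → 2 ≤ alphSize _≟_ w →
    let a = alphSize _≟_ w
        m = r ⊓ k
        M = r ⊔ k
        Cw = C _≟_ w
        Cond = (Cw 0 ≡ 1)
               × (∀ i → 1 ≤ i → i ≤ m → Cw i ≡ a + i ∸ 1)
               × (∀ i → m ≤ i → i < M → Cw (suc i) ≡ Cw i)
               × (∀ i → M ≤ i → i ≤ length w → Cw (suc i) + 1 ≡ Cw i)
    in (length w ≡ r + k + a ∸ 2 ⇔ Cond)
       × (Cond → (Cw r ≡ Cw k)
                 × (∀ n → Cw n ≤ m + a ∸ 1)
                 × Σ ℕ (λ n → Cw n ≡ m + a ∸ 1))
theorem2p2 _≟_ w r k isR isK 2≤a =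
    ⇔-trans (≡-transport refl (cong (λ s → s + a ∸ 2) (sym (⊓+⊔ r k)))) length⇔profile
  , λ profile → let plateau , bound , attained = profile-peak profile
                in agree-at-min-max c r k plateau , bound , attained
  where
  open Factors _≟_ w
  a : ℕ
  a = alphSize _≟_ w
  1≤L : 1 ≤ L
  1≤L = ≤-trans (s≤s z≤n) (≤-trans 2≤a (length-deduplicate _≟_ w))
  climbs : ∀ n → n < r ⊓ k → suc (c n) ≤ c (suc n)
  climbs n n<m = c-climbs isR isK 2≤a (m<n⊓o⇒m<n r k n<m) (m<n⊓o⇒m<o r k n<m)
  grows : ∀ n → n < r ⊔ k → c n ≤ c (suc n)
  grows n n<M with ⊔-sel r k
  ... | inj₁ max≡r = c-grows-below-R isR 2≤a (subst (n <_) max≡r n<M)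
  ... | inj₂ max≡k = c-grows-below-K isK (subst (n <_) max≡k n<M)
  open Envelope c L a (r ⊓ k) (r ⊔ k) c-empty c-beyond alphabet≤c1 c-down climbs grows
    (⊓-glb (proj₁ isR) (K-positive 1≤L isK)) (m⊓n≤m⊔n r k) (⊔-lub (R≤L isR 2≤a) (proj₁ isK)) 2≤a
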